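{- There is no complete Mammen space $(U,\mathcal S,\mathcal C)$ with $U\subseteq\mathbb N$ such that $\mathcal S$, regarded as a subset of $\mathcal P(\mathbb N)\cong 2^{\mathbb N}$, is analytic.
   Context: $\mathcal P(\mathbb N)$ is identified with the Cantor space $2^{\mathbb N}$ via characteristic functions; a subset is analytic if it is a continuous image of a Polish space (equivalently, of $\mathbb N^{\mathbb N}$). A \emph{Mammen space} is a triple $(U,\mathcal S,\mathcal C)$ where $U\neq\emptyset$ and $\mathcal S,\mathcal C\subseteq\mathcal P(U)$ satisfy: (1) $\mathcal S$ is a Hausdorff topology on $U$ in which every non-empty open set is infinite; (2) there is a non-empty $C\in\mathcal C$, $\mathcal C$ is closed under finite unions and finite intersections, and every non-empty $C\in\mathcal C$ contains some $x$ with $\{x\}\in\mathcal C$; (3) $\mathcal S\cap\mathcal C=\{\emptyset\}$, and $C\cap S\in\mathcal C$ for $C\in\mathcal C$, $S\in\mathcal S$. It is \emph{complete} if every $X\subseteq U$ can be written as $X=S\cup C$ with $S\in\mathcal S$, $C\in\mathcal C$. -}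

module Defs where

open import Level using (Level; 0ℓ) renaming (suc to lsuc)
open import Data.Nat using (ℕ; _≤_; _<_)
open import Data.Nat.Properties using (_≟_)
open import Data.Bool using (Bool; true; false)
open import Data.Product using (Σ; ∃; ∃-syntax; _×_; _,_)
open import Relation.Binary.PropositionalEquality using (_≡_)
open import Relation.Nullary using (¬_)
open import Relation.Nullary.Decidable using (⌊_⌋)
open import Axiom.ExcludedMiddle using (ExcludedMiddle)

Subset : Set
Subset = ℕ → Bool

_∈_ : ℕ → Subset → Set
n ∈ A = A n ≡ true

Family : Set₁
Family = Subset → Set

_⊆_ : Subset → Subset → Set
A ⊆ B = ∀ n → n ∈ A → n ∈ B

_≐_ : Subset → Subset → Set
A ≐ B = ∀ n → A n ≡ B n

∅ : Subset
∅ = λ _ → false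

_∩_ : Subset → Subset → Subset
(A ∩ B) n = Data.Bool._∧_ (A n) (B n)

_∪_ : Subset → Subset → Subset
(A ∪ B) n = Data.Bool._∨_ (A n) (B n)

｛_｝ : ℕ → Subset
｛ x ｝ = λ n → ⌊ n ≟ x ⌋

NonEmpty : Subset → Set
NonEmpty A = ∃[ n ] n ∈ A

Infinite : Subset → Set
Infinite A = ∀ m → ∃[ n ] (m ≤ n × n ∈ A)

-- A family is a family of subsets of U, respecting extensional equality
-- (families are sets of sets, so membership only depends on the set).
FamilyOn : Subset → Family → Set
FamilyOn U 𝓕 = (∀ A → 𝓕 A → A ⊆ U) × (∀ A B → A ≐ B → 𝓕 A → 𝓕 B)

IsUnionOf : Subset → Family → Set
IsUnionOf W 𝓕 = ∀ n → (n ∈ W → ∃[ A ] (𝓕 A × n ∈ A)) × (∃[ A ] (𝓕 A × n ∈ A) → n ∈ W)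

IsTopology : Subset → Family → Set₁
IsTopology U 𝒮 =
  FamilyOn U 𝒮
  × 𝒮 U
  × (∀ A B → 𝒮 A → 𝒮 B → 𝒮 (A ∩ B))
  × (∀ (𝓕 : Family) (W : Subset) → (∀ A → 𝓕 A → 𝒮 A) → IsUnionOf W 𝓕 → 𝒮 W)

IsHausdorff : Subset → Family → Set
IsHausdorff U 𝒮 =
  ∀ x y → x ∈ U → y ∈ U → ¬ (x ≡ y) →
    ∃[ A ] ∃[ B ] (𝒮 A × 𝒮 B × x ∈ A × y ∈ B × ((A ∩ B) ≐ ∅))

MammenS : Subset → Family → Set₁
MammenS U 𝒮 =
  IsTopology U 𝒮 × IsHausdorff U 𝒮 × (∀ A → 𝒮 A → NonEmpty A → Infinite A)

MammenC : Subset → Family → Set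
MammenC U 𝒞 =
  FamilyOn U 𝒞
  × (∃[ C ] (𝒞 C × NonEmpty C))
  × (∀ A B → 𝒞 A → 𝒞 B → 𝒞 (A ∪ B))
  × (∀ A B → 𝒞 A → 𝒞 B → 𝒞 (A ∩ B))
  × (∀ C → 𝒞 C → NonEmpty C → ∃[ x ] (x ∈ C × 𝒞 ｛ x ｝))

MammenSC : Family → Family → Set
MammenSC 𝒮 𝒞 =
  𝒮 ∅ × 𝒞 ∅
  × (∀ A → 𝒮 A → 𝒞 A → A ≐ ∅)
  × (∀ C S → 𝒞 C → 𝒮 S → 𝒞 (C ∩ S))

IsMammenSpace : Subset → Family → Family → Set₁
IsMammenSpace U 𝒮 𝒞 =
  NonEmpty U × MammenS U 𝒮 × MammenC U 𝒞 × MammenSC 𝒮 𝒞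

IsComplete : Subset → Family → Family → Set
IsComplete U 𝒮 𝒞 =
  ∀ X → X ⊆ U → ∃[ S ] ∃[ C ] (𝒮 S × 𝒞 C × X ≐ (S ∪ C))

-- Baire space and continuity (product topologies on ℕ^ℕ and 2^ℕ).
Baire : Set
Baire = ℕ → ℕ

Continuous : (Baire → Subset) → Set
Continuous f =
  ∀ α n → ∃[ m ] (∀ β → (∀ i → i < m → β i ≡ α i) → f β n ≡ f α n)

Analytic : Family → Set
Analytic 𝒮 =
  ∃[ f ] (Continuous f × (∀ A → 𝒮 A → ∃[ α ] (f α ≐ A))
                       × (∀ α → 𝒮 (f α)))

module Submission where

-- Let f : ℕ^ℕ → 𝒫(ℕ) be a continuous map onto 𝒮. In the game below player I builds a point n
-- and a code α, and both players alternately extend a colouring X : ℕ → Bool; I wins when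
-- n ∈ f α and f α is X-monochromatic. Losing is an open condition for I, so classically either
-- II has a well-founded winning strategy or I never loses. In the first case a colouring built
-- by diagonalising against the countably many positions of II's strategy splits every nonempty
-- f α. In the second case I can play two games whose colourings agree below some N > n and are
-- complementary beyond it, with the same first point n; the two monochromatic sets f αA, f αB
-- meet in n, so their intersection, a nonempty member of 𝒮, is infinite and contains some
-- j ≥ N, which then gets both colours.
-- So some X splits every member of 𝒮. By completeness U ∩ X = S ∪ C with S ∈ 𝒮; S is
-- monochromatic, hence empty, so U ∩ X ∈ 𝒞, likewise U ∖ X, hence U ∈ 𝒮 ∩ 𝒞 = {∅}.

open import Defs
open import Level using (0ℓ) renaming (suc to lsuc)
open import Axiom.ExcludedMiddle using (ExcludedMiddle)
open import Axiom.DoubleNegationElimination using (DoubleNegationElimination; em⇒dne)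
open import Data.Bool using (Bool; true; false; not; _∧_; _∨_; _≟_)
open import Data.Bool.Properties using (not-involutive; not-injective; not-¬)
open import Data.Empty using (⊥; ⊥-elim)
open import Data.List using (List; []; _∷_; _++_; [_]; length; map; replicate)
open import Data.List.Properties using (++-assoc; ++-identityʳ; length-++; length-map; length-replicate; map-++)
open import Data.Nat using (ℕ; zero; suc; _+_; _≤_; _<_; _≤′_; ≤′-reflexive; ≤′-step; z≤n; s≤s; _⊔_; _≡ᵇ_)
open import Data.Nat.Properties
  using (≤-refl; ≤-reflexive; ≤-trans; m≤n⇒m≤1+n; ≤⇒≤′; m≤m+n; m≤n+m; m≤m⊔n; m≤n⊔m; +-suc; +-identityʳ)
open import Data.Nat.Binary.Base using (ℕᵇ; 2[1+_]; 1+[2_]; fromℕ; toℕ) renaming (zero to 0ᵇ)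
open import Data.Nat.Binary.Properties using (fromℕ-toℕ)
open import Data.Product using (Σ; ∃₂; ∃-syntax; _×_; _,_; proj₁; proj₂)
open import Data.Sum using (_⊎_; inj₁; inj₂)
open import Data.Unit using (⊤; tt)
open import Function using (_∘_)
open import Relation.Binary.Definitions using (DecidableEquality)
open import Relation.Binary.PropositionalEquality using (_≡_; _≢_; refl; sym; trans; cong; cong₂; subst; module ≡-Reasoning)
open import Relation.Nullary using (¬_; yes; no)

-- Finite prefixes of sequences

module _ {A : Set} where

  infix 4 _⊑_ _≼_

  _⊑_ : List A → (ℕ → A) → Set
  [] ⊑ X = ⊤
  (x ∷ s) ⊑ X = X 0 ≡ x × s ⊑ X ∘ suc

  at : A → List A → ℕ → A
  at d [] i = d
  at d (x ∷ s) zero = x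
  at d (x ∷ s) (suc i) = at d s i

  ⊑-++⁻ˡ : ∀ s {r} {X : ℕ → A} → s ++ r ⊑ X → s ⊑ X
  ⊑-++⁻ˡ [] _ = tt
  ⊑-++⁻ˡ (x ∷ s) (X0≡x , s++r⊑) = X0≡x , ⊑-++⁻ˡ s s++r⊑

  ⊑-++⁺ : ∀ s {r} {X : ℕ → A} → s ⊑ X → r ⊑ X ∘ (length s +_) → s ++ r ⊑ X
  ⊑-++⁺ [] _ r⊑ = r⊑
  ⊑-++⁺ (x ∷ s) (X0≡x , s⊑) r⊑ = X0≡x , ⊑-++⁺ s s⊑ r⊑

  at-⊑ : ∀ d s {X : ℕ → A} → (∀ i → i < length s → X i ≡ at d s i) → s ⊑ X
  at-⊑ d [] _ = tt
  at-⊑ d (x ∷ s) X≡ = X≡ 0 (s≤s z≤n) , at-⊑ d s (λ i i< → X≡ (suc i) (s≤s i<))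

  ⊑-agree : ∀ s {X Y : ℕ → A} → s ⊑ X → s ⊑ Y → ∀ i → i < length s → X i ≡ Y i
  ⊑-agree (x ∷ s) (X0≡x , _) (Y0≡x , _) zero _ = trans X0≡x (sym Y0≡x)
  ⊑-agree (x ∷ s) (_ , s⊑X) (_ , s⊑Y) (suc i) (s≤s i<) = ⊑-agree s s⊑X s⊑Y i i<

  at-++ˡ : ∀ d s {r} i → i < length s → at d (s ++ r) i ≡ at d s i
  at-++ˡ d (x ∷ s) zero _ = refl
  at-++ˡ d (x ∷ s) (suc i) (s≤s i<) = at-++ˡ d s i i<

  _≼_ : List A → List A → Set
  s ≼ r = ∃[ e ] r ≡ s ++ e

  ≼-refl : ∀ s → s ≼ s
  ≼-refl s = [] , sym (++-identityʳ s)

  ≼-trans : ∀ {s r q} → s ≼ r → r ≼ q → s ≼ q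
  ≼-trans {s} (e , refl) (e′ , refl) = e ++ e′ , ++-assoc s e e′

  ≼-++ : ∀ s e → s ≼ s ++ e
  ≼-++ s e = e , refl

  ++⁺-≼ : ∀ s {e e′} → e ≼ e′ → s ++ e ≼ s ++ e′
  ++⁺-≼ s {e} (d , refl) = d , sym (++-assoc s e d)

  ≼-⊑ : ∀ {s r} {X : ℕ → A} → s ≼ r → r ⊑ X → s ⊑ X
  ≼-⊑ {s} (e , refl) = ⊑-++⁻ˡ s

  ≼-length : ∀ {s r} → s ≼ r → length s ≤ length r
  ≼-length {s} (e , refl) = ≤-trans (m≤m+n (length s) (length e)) (≤-reflexive (sym (length-++ s)))

  ≼-at : ∀ d {s r} → s ≼ r → ∀ i → i < length s → at d r i ≡ at d s i
  ≼-at d {s} (e , refl) = at-++ˡ d s {e}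

  <-length-++-∷ : (s : List A) {x : A} (e : List A) → length s < length (s ++ x ∷ e)
  <-length-++-∷ s {x} e = ≤-trans (s≤s (m≤m+n (length s) (length e)))
                            (≤-reflexive (sym (trans (length-++ s {x ∷ e}) (+-suc (length s) (length e)))))

  Apart : List A → List A → Set
  Apart s r = ∀ X → s ⊑ X → r ⊑ X → ⊥

  ≼-compare : DecidableEquality A → ∀ s r → r ≼ s ⊎ s ≼ r ⊎ Apart s r
  ≼-compare _≟_ [] r = inj₂ (inj₁ (r , refl))
  ≼-compare _≟_ (x ∷ s) [] = inj₁ (x ∷ s , refl)
  ≼-compare _≟_ (x ∷ s) (y ∷ r) with x ≟ y
  ... | no x≢y = inj₂ (inj₂ λ X (X0≡x , _) (X0≡y , _) → x≢y (trans (sym X0≡x) X0≡y))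
  ... | yes refl with ≼-compare _≟_ s r
  ...   | inj₁ (e , r≡) = inj₁ (e , cong (x ∷_) r≡)
  ...   | inj₂ (inj₁ (e , s≡)) = inj₂ (inj₁ (e , cong (x ∷_) s≡))
  ...   | inj₂ (inj₂ apart) = inj₂ (inj₂ λ X (_ , s⊑) (_ , r⊑) → apart (X ∘ suc) s⊑ r⊑)

  module Limit (d : A) (c : ℕ → List A) (c-≼ : ∀ k → c k ≼ c (suc k))
               (c-grows : ∀ k → k ≤ length (c k)) where

    lim : ℕ → A
    lim i = at d (c (suc i)) i

    c-mono′ : ∀ {k l} → k ≤′ l → c k ≼ c l
    c-mono′ (≤′-reflexive refl) = ≼-refl _
    c-mono′ (≤′-step k≤′l) = ≼-trans (c-mono′ k≤′l) (c-≼ _)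

    lim-at : ∀ k i → i < length (c k) → lim i ≡ at d (c k) i
    lim-at k i i< = trans (sym (≼-at d (c-mono′ (≤⇒≤′ (m≤n⊔m k (suc i)))) i (c-grows (suc i))))
                          (≼-at d (c-mono′ (≤⇒≤′ (m≤m⊔n k (suc i)))) i i<)

    lim-⊑ : ∀ k → c k ⊑ lim
    lim-⊑ k = at-⊑ d (c k) (lim-at k)

at-map : {A B : Set} (g : A → B) {d : A} {d′ : B} (s : List A) → ∀ i → i < length s →
         at d′ (map g s) i ≡ g (at d s i)
at-map g (x ∷ s) zero _ = refl
at-map g (x ∷ s) (suc i) (s≤s i<) = at-map g s i i<

-- Enumerations

Enumeration : Set → Set
Enumeration A = Σ (ℕ → A) λ e → ∀ x → ∃[ k ] e k ≡ x

enumeration-map : {A B : Set} → Enumeration A → (g : A → B) → (∀ y → ∃[ x ] g x ≡ y) → Enumeration B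
enumeration-map (e , onto) g g-onto =
  g ∘ e , λ y → let x , gx≡y = g-onto y ; k , ek≡x = onto x in k , trans (cong g ek≡x) gx≡y

enumeration-ℕ : Enumeration ℕ
enumeration-ℕ = (λ k → k) , λ k → k , refl

-- A binary numeral is read as a list of run lengths: 1+[2_] closes a run, 2[1+_] lengthens it.
runs : ℕᵇ → List ℕ
runs 0ᵇ = []
runs 1+[2 x ] = 0 ∷ runs x
runs 2[1+ x ] with runs x
... | [] = []
... | n ∷ ns = suc n ∷ ns

lengthen : ℕ → ℕᵇ → ℕᵇ
lengthen zero x = x
lengthen (suc n) x = 2[1+ lengthen n x ]

unruns : List ℕ → ℕᵇ
unruns [] = 0ᵇ
unruns (n ∷ ns) = lengthen n 1+[2 unruns ns ]

runs-unruns : ∀ ns → runs (unruns ns) ≡ ns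
runs-unruns [] = refl
runs-unruns (n ∷ ns) = runs-lengthen n
  where
  runs-lengthen : ∀ m → runs (lengthen m 1+[2 unruns ns ]) ≡ m ∷ ns
  runs-lengthen zero = cong (0 ∷_) (runs-unruns ns)
  runs-lengthen (suc m) rewrite runs-lengthen m = refl

enumeration-List-ℕ : Enumeration (List ℕ)
enumeration-List-ℕ = enumeration-map (fromℕ , λ x → toℕ x , fromℕ-toℕ x) runs (λ ns → unruns ns , runs-unruns ns)

enumeration-ℕ×ℕ : Enumeration (ℕ × ℕ)
enumeration-ℕ×ℕ = enumeration-map enumeration-List-ℕ first-two (λ (m , n) → m ∷ n ∷ [] , refl)
  where
  first-two : List ℕ → ℕ × ℕ
  first-two (m ∷ n ∷ _) = m , n
  first-two _ = 0 , 0

enumeration-× : {A B : Set} → Enumeration A → Enumeration B → Enumeration (A × B)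
enumeration-× (eA , ontoA) (eB , ontoB) =
  enumeration-map enumeration-ℕ×ℕ (λ (m , n) → eA m , eB n)
    λ (x , y) → let m , eAm≡x = ontoA x ; n , eBn≡y = ontoB y in (m , n) , cong₂ _,_ eAm≡x eBn≡y

enumeration-List : {A : Set} → Enumeration A → Enumeration (List A)
enumeration-List {A} (e , onto) = enumeration-map enumeration-List-ℕ (map e) codes
  where
  codes : ∀ xs → ∃[ ns ] map e ns ≡ xs
  codes [] = [] , refl
  codes (x ∷ xs) = let n , en≡x = onto x ; ns , ens≡xs = codes xs in n ∷ ns , cong₂ _∷_ en≡x ens≡xs

enumeration-Bool : Enumeration Bool
enumeration-Bool = enumeration-map enumeration-ℕ (_≡ᵇ 0) λ { true → 0 , refl ; false → 1 , refl }

-- Colourings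

∧-≡-true⁻ : ∀ {a b} → a ∧ b ≡ true → a ≡ true × b ≡ true
∧-≡-true⁻ {true} b≡true = refl , b≡true

map-not-involutive : ∀ s → map not (map not s) ≡ s
map-not-involutive [] = refl
map-not-involutive (b ∷ s) = cong₂ _∷_ (not-involutive b) (map-not-involutive s)

≼-nonempty : ∀ e → ∃₂ λ b u → e ≼ b ∷ u
≼-nonempty [] = false , [] , [ false ] , refl
≼-nonempty (b ∷ u) = b , u , ≼-refl (b ∷ u)

flipFrom : ℕ → List Bool → List Bool
flipFrom zero s = map not s
flipFrom (suc N) [] = []
flipFrom (suc N) (b ∷ s) = b ∷ flipFrom N s

length-flipFrom : ∀ N s → length (flipFrom N s) ≡ length s
length-flipFrom zero s = length-map not s
length-flipFrom (suc N) [] = refl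
length-flipFrom (suc N) (b ∷ s) = cong suc (length-flipFrom N s)

flipFrom-length : ∀ s → flipFrom (length s) s ≡ s
flipFrom-length [] = refl
flipFrom-length (b ∷ s) = cong (b ∷_) (flipFrom-length s)

flipFrom-++ : ∀ N s u → N ≤ length s → flipFrom N (s ++ u) ≡ flipFrom N s ++ map not u
flipFrom-++ zero s u _ = map-++ not s u
flipFrom-++ (suc N) (b ∷ s) u (s≤s N≤) = cong (b ∷_) (flipFrom-++ N s u N≤)

flipFrom-++-map-not : ∀ N s u → N ≤ length s → flipFrom N (s ++ map not u) ≡ flipFrom N s ++ u
flipFrom-++-map-not N s u N≤ =
  trans (flipFrom-++ N s (map not u) N≤) (cong (flipFrom N s ++_) (map-not-involutive u))

at-flipFrom-< : ∀ {N} s {i} → i < N → at false (flipFrom N s) i ≡ at false s i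
at-flipFrom-< {suc N} [] _ = refl
at-flipFrom-< {suc N} (b ∷ s) {zero} _ = refl
at-flipFrom-< {suc N} (b ∷ s) {suc i} (s≤s i<N) = at-flipFrom-< s i<N

at-flipFrom-≥ : ∀ {N} s {i} → N ≤ i → i < length s → at false (flipFrom N s) i ≡ not (at false s i)
at-flipFrom-≥ {zero} s i< = at-map not s _
at-flipFrom-≥ {suc N} (b ∷ s) {suc i} (s≤s N≤i) (s≤s i<) = at-flipFrom-≥ s N≤i i<

Splits : Subset → Subset → Set
Splits X A = ∀ n → n ∈ A → ¬ (∀ i → i ∈ A → X i ≡ X n)

-- The game

¬∀⇒∃¬ : DoubleNegationElimination 0ℓ → {B : Set} {P : B → Set} → ¬ (∀ x → P x) → ∃[ x ] ¬ P x
¬∀⇒∃¬ dne ¬∀ = dne λ ¬∃ → ¬∀ λ x → dne λ ¬Px → ¬∃ (x , ¬Px)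

_◂_ : ℕ → Baire → Baire
(n ◂ α) zero = n
(n ◂ α) (suc i) = α i

AgreeBelow : {A : Set} → ℕ → (ℕ → A) → (ℕ → A) → Set
AgreeBelow K X X′ = ∀ i → i < K → X′ i ≡ X i

-- Player I colours at least one new point per move, so that every play colours all of ℕ.
record Move : Set where
  constructor move
  field
    point : ℕ
    first : Bool
    rest : List Bool

  block : List Bool
  block = first ∷ rest

record Position : Set where
  constructor position
  field
    colours : List Bool
    points : List ℕ

open Move
open Position

root : Position
root = position [] []

infixl 6 _⊕I_ _⊕II_

_⊕I_ : Position → Move → Position
q ⊕I m = position (colours q ++ block m) (points q ++ [ point m ])

_⊕II_ : Position → List Bool → Position
q ⊕II r = position (colours q ++ r) (points q)

⊕-colours-≼ : ∀ q m r → colours q ≼ colours (q ⊕I m ⊕II r)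
⊕-colours-≼ q m r = ≼-trans (≼-++ (colours q) (block m)) (≼-++ _ r)

⊕-colours-grows : ∀ q m r → length (colours q) < length (colours (q ⊕I m ⊕II r))
⊕-colours-grows q m r = ≤-trans (<-length-++-∷ (colours q) (rest m)) (≼-length (≼-++ (colours q ++ block m) r))

⊕-points-grows : ∀ q m r → length (points q) < length (points (q ⊕I m ⊕II r))
⊕-points-grows q m r = <-length-++-∷ (points q) []

enumeration-Move : Enumeration Move
enumeration-Move =
  enumeration-map
    (enumeration-× enumeration-ℕ (enumeration-× enumeration-Bool (enumeration-List enumeration-Bool)))
    (λ (a , b , u) → move a b u) (λ m → (point m , first m , rest m) , refl)

module Game (lem : ExcludedMiddle 0ℓ) (f : Baire → Subset) (cont : Continuous f) where

  dne : DoubleNegationElimination 0ℓ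
  dne = em⇒dne lem

  Witnesses : Subset → Baire → Set
  Witnesses X y = y 0 ∈ f (y ∘ suc) × (∀ i → i ∈ f (y ∘ suc) → X i ≡ X (y 0))

  f-tail-stable : ∀ y i → ∃[ K ] ∀ y′ → AgreeBelow K y y′ → f (y′ ∘ suc) i ≡ f (y ∘ suc) i
  f-tail-stable y i =
    let K , stable = cont (y ∘ suc) i
    in suc K , λ y′ y≈ → stable (y′ ∘ suc) λ j j< → y≈ (suc j) (s≤s j<)

  ¬Witnesses-open : ∀ X y → ¬ Witnesses X y →
    ∃[ K ] ∀ X′ y′ → AgreeBelow K X X′ → AgreeBelow K y y′ → ¬ Witnesses X′ y′
  ¬Witnesses-open X y ¬w with f (y ∘ suc) (y 0) in fy0
  ... | false = suc K , λ _ y′ _ y≈ (y′0∈ , _) → not-¬ refl (begin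
        true ≡⟨ sym y′0∈ ⟩
        f (y′ ∘ suc) (y′ 0) ≡⟨ cong (f (y′ ∘ suc)) (y≈ 0 (s≤s z≤n)) ⟩
        f (y′ ∘ suc) (y 0) ≡⟨ stable y′ (λ i i< → y≈ i (m≤n⇒m≤1+n i<)) ⟩
        f (y ∘ suc) (y 0) ≡⟨ fy0 ⟩
        false ∎)
    where
    open ≡-Reasoning
    K = proj₁ (f-tail-stable y (y 0))
    stable = proj₂ (f-tail-stable y (y 0))
  ... | true with lem {∃[ i ] i ∈ f (y ∘ suc) × X i ≢ X (y 0)}
  ...   | no ¬split = ⊥-elim (¬w (refl , λ i i∈ → dne λ Xi≢ → ¬split (i , i∈ , Xi≢)))
  ...   | yes (i , i∈ , Xi≢) = K , λ X′ y′ X≈ y≈ (_ , mono′) → Xi≢ (begin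
        X i ≡⟨ sym (X≈ i i<K) ⟩
        X′ i ≡⟨ mono′ i (trans (stable y′ (λ j j< → y≈ j (≤-trans j< Kᵢ≤K))) i∈) ⟩
        X′ (y′ 0) ≡⟨ cong X′ (y≈ 0 0<K) ⟩
        X′ (y 0) ≡⟨ X≈ (y 0) y0<K ⟩
        X (y 0) ∎)
    where
    open ≡-Reasoning
    Kᵢ = proj₁ (f-tail-stable y i)
    stable = proj₂ (f-tail-stable y i)
    K = Kᵢ ⊔ suc (i ⊔ y 0)
    Kᵢ≤K = m≤m⊔n Kᵢ (suc (i ⊔ y 0))
    i<K = ≤-trans (s≤s (m≤m⊔n i (y 0))) (m≤n⊔m Kᵢ (suc (i ⊔ y 0)))
    y0<K = ≤-trans (s≤s (m≤n⊔m i (y 0))) (m≤n⊔m Kᵢ (suc (i ⊔ y 0)))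
    0<K = ≤-trans (s≤s z≤n) y0<K

  Refuted : Position → Set
  Refuted q = ∀ X y → colours q ⊑ X → points q ⊑ y → ¬ Witnesses X y

  -- Since I's losing condition is open, II's winning strategies can be taken well-founded.
  data IIWins : Position → Set where
    refuted : ∀ {q} → Refuted q → IIWins q
    respond : ∀ {q} (r : Move → List Bool) → (∀ m → IIWins (q ⊕I m ⊕II r m)) → IIWins q

  unbeaten-move : ∀ {q} → ¬ IIWins q → ∃[ m ] ∀ r → ¬ IIWins (q ⊕I m ⊕II r)
  unbeaten-move {q} ¬w =
    let m , ¬answer = ¬∀⇒∃¬ dne {P = λ m → ∃[ r ] IIWins (q ⊕I m ⊕II r)}
                        λ answer → ¬w (respond (proj₁ ∘ answer) (proj₂ ∘ answer))
    in m , λ r w → ¬answer (r , w)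

  module UnbeatenPlay (qs : ℕ → Position)
                      (next : ∀ k → ∃₂ λ m r → qs (suc k) ≡ qs k ⊕I m ⊕II r)
                      (unbeaten : ∀ k → ¬ IIWins (qs k)) where

    colours-≼ : ∀ k → colours (qs k) ≼ colours (qs (suc k))
    colours-≼ k with next k
    ... | m , r , eq rewrite eq = ⊕-colours-≼ (qs k) m r

    points-≼ : ∀ k → points (qs k) ≼ points (qs (suc k))
    points-≼ k with next k
    ... | m , r , eq rewrite eq = ≼-++ (points (qs k)) [ point m ]

    colours-grow : ∀ k → k ≤ length (colours (qs k))
    colours-grow zero = z≤n
    colours-grow (suc k) with next k
    ... | m , r , eq rewrite eq = ≤-trans (s≤s (colours-grow k)) (⊕-colours-grows (qs k) m r)

    points-grow : ∀ k → k ≤ length (points (qs k))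
    points-grow zero = z≤n
    points-grow (suc k) with next k
    ... | m , r , eq rewrite eq = ≤-trans (s≤s (points-grow k)) (⊕-points-grows (qs k) m r)

    module Colours = Limit false (colours ∘ qs) colours-≼ colours-grow
    module Points = Limit 0 (points ∘ qs) points-≼ points-grow

    colouring : Subset
    colouring = Colours.lim

    witness : Baire
    witness = Points.lim

    witnesses : Witnesses colouring witness
    witnesses = dne λ ¬w →
      let K , open-nbhd = ¬Witnesses-open colouring witness ¬w
      in unbeaten K (refuted λ X y cK⊑X pK⊑y → open-nbhd X y
           (λ i i<K → ⊑-agree (colours (qs K)) cK⊑X (Colours.lim-⊑ K) i (≤-trans i<K (colours-grow K)))
           (λ i i<K → ⊑-agree (points (qs K)) pK⊑y (Points.lim-⊑ K) i (≤-trans i<K (points-grow K))))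

  Node : Set
  Node = Σ Position IIWins

  descend : Node → List Move → Node
  descend node [] = node
  descend (q , refuted h) (_ ∷ _) = q , refuted h
  descend (q , respond r w) (m ∷ π) = descend (q ⊕I m ⊕II r m , w m) π

  descend-refuted : ∀ q (h : Refuted q) π → descend (q , refuted h) π ≡ (q , refuted h)
  descend-refuted q h [] = refl
  descend-refuted q h (_ ∷ _) = refl

  descend-++ : ∀ node π π′ → descend node (π ++ π′) ≡ descend (descend node π) π′
  descend-++ node [] π′ = refl
  descend-++ (q , refuted h) (_ ∷ _) π′ = sym (descend-refuted q h π′)
  descend-++ (q , respond r w) (m ∷ π) π′ = descend-++ (_ , w m) π π′

  Meets : List Bool → Node → ℕ → Set
  Meets c (q , refuted _) a = ⊤
  Meets c (q , respond r _) a =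
    ∀ X → c ⊑ X → colours q ⊑ X → ∃₂ λ b u → colours (q ⊕I move a b u ⊕II r (move a b u)) ⊑ X

  Meets-≼ : ∀ {c c′} node a → c ≼ c′ → Meets c node a → Meets c′ node a
  Meets-≼ (q , refuted _) a _ _ = tt
  Meets-≼ (q , respond r _) a c≼c′ meets X c′⊑X = meets X (≼-⊑ c≼c′ c′⊑X)

  meet : ∀ c node a → ∃[ c′ ] c ≼ c′ × Meets c′ node a
  meet c (q , refuted _) a = c , ≼-refl c , tt
  meet c (q , respond r w) a = by-comparison (≼-compare _≟_ c (colours q))
    where
    after : Bool → List Bool → List Bool
    after b u = colours (q ⊕I move a b u ⊕II r (move a b u))

    meets-after : ∀ b u → Meets (after b u) (q , respond r w) a
    meets-after b u X after⊑X _ = b , u , after⊑X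

    by-comparison : colours q ≼ c ⊎ c ≼ colours q ⊎ Apart c (colours q) →
                    ∃[ c′ ] c ≼ c′ × Meets c′ (q , respond r w) a
    by-comparison (inj₁ (e , c≡)) =
      let b , u , e≼bu = ≼-nonempty e
      in after b u , ≼-trans (subst (_≼ colours q ++ b ∷ u) (sym c≡) (++⁺-≼ (colours q) e≼bu))
                             (≼-++ _ (r (move a b u))) , meets-after b u
    by-comparison (inj₂ (inj₁ c≼q)) =
      after false [] , ≼-trans c≼q (⊕-colours-≼ q (move a false []) _) , meets-after false []
    by-comparison (inj₂ (inj₂ apart)) = c , ≼-refl c , λ X c⊑X q⊑X → ⊥-elim (apart X c⊑X q⊑X)

  module IIWinning (w : IIWins root) where

    start : Node
    start = root , w

    requirements : Enumeration (List Move × ℕ)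
    requirements = enumeration-× (enumeration-List enumeration-Move) enumeration-ℕ

    requirement : ℕ → List Move × ℕ
    requirement = proj₁ requirements

    meet-requirement : ∀ c ((π , a) : List Move × ℕ) →
                       ∃[ c′ ] c ≼ c′ × Meets c′ (descend start π) a
    meet-requirement c (π , a) = meet c (descend start π) a

    -- The appended colour only serves to make the stages grow.
    stage : ℕ → List Bool
    stage zero = []
    stage (suc k) = proj₁ (meet-requirement (stage k) (requirement k)) ++ [ false ]

    stage-≼ : ∀ k → stage k ≼ stage (suc k)
    stage-≼ k = ≼-trans (proj₁ (proj₂ (meet-requirement (stage k) (requirement k)))) (≼-++ _ _)

    stage-grows : ∀ k → k ≤ length (stage k)
    stage-grows zero = z≤n
    stage-grows (suc k) =
      ≤-trans (s≤s (≤-trans (stage-grows k) (≼-length (proj₁ (proj₂ step)))))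
              (<-length-++-∷ (proj₁ step) [])
      where step = meet-requirement (stage k) (requirement k)

    stage-meets : ∀ k → let π , a = requirement k in Meets (stage (suc k)) (descend start π) a
    stage-meets k = Meets-≼ (descend start (proj₁ (requirement k))) (proj₂ (requirement k)) (≼-++ _ _)
                      (proj₂ (proj₂ (meet-requirement (stage k) (requirement k))))

    open Limit false stage stage-≼ stage-grows using (lim; lim-⊑)

    colouring : Subset
    colouring = lim

    refutes : ∀ {q} (v : IIWins q) π → descend start π ≡ (q , v) →
              ∀ y → colours q ⊑ colouring → points q ⊑ y → ¬ Witnesses colouring y
    refutes (refuted h) _ _ y = h colouring y
    refutes {q} (respond r v) π reached y q⊑X q⊑y = refutes (v m) (π ++ [ m ]) reached′ y m⊑X m⊑y
      where
      a = y (length (points q))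
      k = proj₁ (proj₂ requirements (π , a))

      met : Meets (stage (suc k)) (q , respond r v) a
      met = subst (λ node → Meets (stage (suc k)) node a) reached
              (subst (λ (π′ , a′) → Meets (stage (suc k)) (descend start π′) a′)
                     (proj₂ (proj₂ requirements (π , a))) (stage-meets k))

      chosen = met colouring (lim-⊑ (suc k)) q⊑X
      m = move a (proj₁ chosen) (proj₁ (proj₂ chosen))
      m⊑X = proj₂ (proj₂ chosen)

      m⊑y : points q ++ [ a ] ⊑ y
      m⊑y = ⊑-++⁺ (points q) q⊑y (cong y (+-identityʳ _) , tt)

      reached′ : descend start (π ++ [ m ]) ≡ (q ⊕I m ⊕II r m , v m)
      reached′ = trans (descend-++ start π [ m ]) (cong (λ node → descend node [ m ]) reached)

    splits : ∀ α → Splits colouring (f α)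
    splits α n n∈ mono = refutes w [] refl (n ◂ α) tt tt (n∈ , mono)

  module IILoses (pairwise-infinite : ∀ α β → NonEmpty (f α ∩ f β) → Infinite (f α ∩ f β))
                 (¬w : ¬ IIWins root) where

    n : ℕ
    n = point (proj₁ (unbeaten-move ¬w))

    -- II's first answer only makes the prefix shared by both plays below longer than n.
    q₁ : Position
    q₁ = root ⊕I proj₁ (unbeaten-move ¬w) ⊕II replicate n false

    q₁-unbeaten : ¬ IIWins q₁
    q₁-unbeaten = proj₂ (unbeaten-move ¬w) (replicate n false)

    m₁ : Move
    m₁ = proj₁ (unbeaten-move q₁-unbeaten)

    N : ℕ
    N = length (colours (q₁ ⊕I m₁))

    n<N : n < N
    n<N = ≤-trans (s≤s n≤) (≼-length (≼-++ (colours q₁) (block m₁)))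
      where
      u = rest (proj₁ (unbeaten-move ¬w))
      n≤ : n ≤ length (u ++ replicate n false)
      n≤ = ≤-trans (m≤n+m n (length u))
             (≤-reflexive (sym (trans (length-++ u) (cong (length u +_) (length-replicate n)))))

    -- Play B runs one move of I ahead of play A, and II answers each move of I in one play
    -- with the negated block in the other, so beyond N the two colourings are complementary.
    record MirroredPair : Set where
      field
        A B : Position
        pending : Move
        A-unbeaten : ¬ IIWins A
        pending-unbeaten : ∀ r → ¬ IIWins (B ⊕I pending ⊕II r)
        N≤A : N ≤ length (colours A)
        mirrored : colours (B ⊕I pending) ≡ flipFrom N (colours A)

    open MirroredPair

    B₀-unbeaten : ¬ IIWins (q₁ ⊕I m₁ ⊕II [])
    B₀-unbeaten = proj₂ (unbeaten-move q₁-unbeaten) []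

    initial : MirroredPair
    initial = record
      { A = q₁ ⊕I m₁ ⊕II map not (block m₂)
      ; B = q₁ ⊕I m₁ ⊕II []
      ; pending = m₂
      ; A-unbeaten = proj₂ (unbeaten-move q₁-unbeaten) (map not (block m₂))
      ; pending-unbeaten = proj₂ (unbeaten-move B₀-unbeaten)
      ; N≤A = ≼-length (≼-++ P (map not (block m₂)))
      ; mirrored = begin
          (P ++ []) ++ block m₂        ≡⟨ cong (_++ block m₂) (++-identityʳ P) ⟩
          P ++ block m₂                ≡⟨ cong (_++ block m₂) (sym (flipFrom-length P)) ⟩
          flipFrom N P ++ block m₂     ≡⟨ sym (flipFrom-++-map-not N P (block m₂) ≤-refl) ⟩
          flipFrom N (P ++ map not (block m₂)) ∎
      }
      where
      open ≡-Reasoning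
      P = colours (q₁ ⊕I m₁)
      m₂ = proj₁ (unbeaten-move B₀-unbeaten)

    step : MirroredPair → MirroredPair
    step L = record
      { A = A L ⊕I mA ⊕II map not (block mB)
      ; B = B′
      ; pending = mB
      ; A-unbeaten = proj₂ (unbeaten-move (A-unbeaten L)) (map not (block mB))
      ; pending-unbeaten = proj₂ (unbeaten-move B′-unbeaten)
      ; N≤A = ≤-trans (N≤A L) (≼-length (⊕-colours-≼ (A L) mA (map not (block mB))))
      ; mirrored = begin
          (colours (B L ⊕I pending L) ++ map not (block mA)) ++ block mB
            ≡⟨ cong (λ s → (s ++ map not (block mA)) ++ block mB) (mirrored L) ⟩
          (flipFrom N cA ++ map not (block mA)) ++ block mB
            ≡⟨ cong (_++ block mB) (sym (flipFrom-++ N cA (block mA) (N≤A L))) ⟩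
          flipFrom N (cA ++ block mA) ++ block mB
            ≡⟨ sym (flipFrom-++-map-not N (cA ++ block mA) (block mB) N≤A+mA) ⟩
          flipFrom N ((cA ++ block mA) ++ map not (block mB)) ∎
      }
      where
      open ≡-Reasoning
      cA = colours (A L)
      mA = proj₁ (unbeaten-move (A-unbeaten L))
      B′ = B L ⊕I pending L ⊕II map not (block mA)
      B′-unbeaten = pending-unbeaten L (map not (block mA))
      mB = proj₁ (unbeaten-move B′-unbeaten)
      N≤A+mA = ≤-trans (N≤A L) (≼-length (≼-++ cA (block mA)))

    pairs : ℕ → MirroredPair
    pairs zero = initial
    pairs (suc k) = step (pairs k)

    B-unbeaten : ∀ k → ¬ IIWins (B (pairs k))
    B-unbeaten zero = B₀-unbeaten
    B-unbeaten (suc k) = pending-unbeaten (pairs k) _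

    module PlayA = UnbeatenPlay (A ∘ pairs) (λ _ → _ , _ , refl) (A-unbeaten ∘ pairs)
    module PlayB = UnbeatenPlay (B ∘ pairs) (λ _ → _ , _ , refl) B-unbeaten

    XA XB : Subset
    XA = PlayA.colouring
    XB = PlayB.colouring

    XB-flipFrom : ∀ k i → i < length (colours (A (pairs k))) →
                  XB i ≡ at false (flipFrom N (colours (A (pairs k)))) i
    XB-flipFrom k i i< = begin
      XB i                                          ≡⟨ PlayB.Colours.lim-at (suc k) i (≤-trans i<′ (≼-length pre)) ⟩
      at false (colours (B (pairs (suc k)))) i      ≡⟨ ≼-at false pre i i<′ ⟩
      at false (colours (B L ⊕I pending L)) i       ≡⟨ cong (λ s → at false s i) (mirrored L) ⟩
      at false (flipFrom N (colours (A L))) i ∎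
      where
      open ≡-Reasoning
      L = pairs k
      pre = ≼-++ (colours (B L ⊕I pending L)) _
      i<′ : i < length (colours (B L ⊕I pending L))
      i<′ = subst (i <_) (sym (trans (cong length (mirrored L)) (length-flipFrom N (colours (A L))))) i<

    XA≡XB-below : ∀ i → i < N → XA i ≡ XB i
    XA≡XB-below i i<N = begin
      XA i                                 ≡⟨ PlayA.Colours.lim-at 0 i i< ⟩
      at false (colours (A initial)) i     ≡⟨ sym (at-flipFrom-< (colours (A initial)) i<N) ⟩
      at false (flipFrom N (colours (A initial))) i ≡⟨ sym (XB-flipFrom 0 i i<) ⟩
      XB i ∎
      where
      open ≡-Reasoning
      i< = ≤-trans i<N (N≤A initial)

    XB≡not-XA-beyond : ∀ i → N ≤ i → XB i ≡ not (XA i)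
    XB≡not-XA-beyond i N≤i = begin
      XB i                                     ≡⟨ XB-flipFrom k i i< ⟩
      at false (flipFrom N (colours (A L))) i  ≡⟨ at-flipFrom-≥ (colours (A L)) N≤i i< ⟩
      not (at false (colours (A L)) i)         ≡⟨ cong not (sym (PlayA.Colours.lim-at k i i<)) ⟩
      not (XA i) ∎
      where
      open ≡-Reasoning
      k = suc i
      L = pairs k
      i< = PlayA.colours-grow k

    contradiction : ⊥
    contradiction = not-¬ refl (begin
      XA j                ≡⟨ proj₂ PlayA.witnesses j j∈A ⟩
      XA (PlayA.witness 0) ≡⟨ cong XA yA0 ⟩
      XA n                ≡⟨ XA≡XB-below n n<N ⟩
      XB n                ≡⟨ cong XB (sym yB0) ⟩
      XB (PlayB.witness 0) ≡⟨ sym (proj₂ PlayB.witnesses j j∈B) ⟩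
      XB j                ≡⟨ XB≡not-XA-beyond j N≤j ⟩
      not (XA j) ∎)
      where
      open ≡-Reasoning
      αA = PlayA.witness ∘ suc
      αB = PlayB.witness ∘ suc
      yA0 : PlayA.witness 0 ≡ n
      yA0 = PlayA.Points.lim-at 0 0 (s≤s z≤n)
      yB0 : PlayB.witness 0 ≡ n
      yB0 = PlayB.Points.lim-at 0 0 (s≤s z≤n)
      n∈A : n ∈ f αA
      n∈A = subst (_∈ f αA) yA0 (proj₁ PlayA.witnesses)
      n∈B : n ∈ f αB
      n∈B = subst (_∈ f αB) yB0 (proj₁ PlayB.witnesses)
      common = pairwise-infinite αA αB (n , cong₂ _∧_ n∈A n∈B) N
      j = proj₁ common
      N≤j = proj₁ (proj₂ common)
      j∈A = proj₁ (∧-≡-true⁻ (proj₂ (proj₂ common)))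
      j∈B = proj₂ (∧-≡-true⁻ (proj₂ (proj₂ common)))

  splitting-colouring : (∀ α β → NonEmpty (f α ∩ f β) → Infinite (f α ∩ f β)) →
                        ∃[ X ] ∀ α → Splits X (f α)
  splitting-colouring pairwise-infinite with lem {IIWins root}
  ... | yes w = IIWinning.colouring w , IIWinning.splits w
  ... | no ¬w = ⊥-elim (IILoses.contradiction pairwise-infinite ¬w)

-- Mammen spaces

Splits-≐ : ∀ {X A B} → A ≐ B → Splits X A → Splits X B
Splits-≐ A≐B splits n n∈B mono =
  splits n (trans (A≐B n) n∈B) λ i i∈A → mono i (trans (sym (A≐B i)) i∈A)

Splits-not : ∀ {X A} → Splits X A → Splits (not ∘ X) A
Splits-not splits n n∈ mono = splits n n∈ λ i i∈ → not-injective (mono i i∈)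

∧-∨-∧-not : ∀ u x → (u ∧ x) ∨ (u ∧ not x) ≡ u
∧-∨-∧-not true true = refl
∧-∨-∧-not true false = refl
∧-∨-∧-not false x = refl

module _ {U : Subset} {𝒮 𝒞 : Family} (complete : IsComplete U 𝒮 𝒞)
         (𝒞-≐ : ∀ A B → A ≐ B → 𝒞 A → 𝒞 B) where

  colour-class-∈𝒞 : ∀ X → (∀ S → 𝒮 S → Splits X S) → 𝒞 (U ∩ X)
  colour-class-∈𝒞 X splits = 𝒞-≐ C (U ∩ X) C≐ C∈𝒞
    where
    decomposition = complete (U ∩ X) λ i i∈ → proj₁ (∧-≡-true⁻ i∈)
    S = proj₁ decomposition
    C = proj₁ (proj₂ decomposition)
    S∈𝒮 = proj₁ (proj₂ (proj₂ decomposition))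
    C∈𝒞 = proj₁ (proj₂ (proj₂ (proj₂ decomposition)))
    U∩X≐ = proj₂ (proj₂ (proj₂ (proj₂ decomposition)))

    X-on-S : ∀ i → i ∈ S → X i ≡ true
    X-on-S i i∈S = proj₂ (∧-≡-true⁻ (trans (U∩X≐ i) (cong (_∨ C i) i∈S)))

    S-empty : ∀ i → S i ≡ false
    S-empty i with S i in i∈S
    ... | false = refl
    ... | true = ⊥-elim (splits S S∈𝒮 i i∈S λ j j∈S → trans (X-on-S j j∈S) (sym (X-on-S i i∈S)))

    C≐ : C ≐ (U ∩ X)
    C≐ i = sym (trans (U∩X≐ i) (cong (_∨ C i) (S-empty i)))

mainTheorem6 : ExcludedMiddle 0ℓ → ExcludedMiddle (lsuc 0ℓ) →
    ¬ (∃[ U ] ∃[ 𝒮 ] ∃[ 𝒞 ] (IsMammenSpace U 𝒮 𝒞 × IsComplete U 𝒮 𝒞 × Analytic 𝒮))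
mainTheorem6 lem _ (U , 𝒮 , 𝒞 , ((n , n∈U) , ((_ , U∈𝒮 , ∩-closed , _) , _ , infinite) ,
                                ((_ , 𝒞-≐) , _ , ∪-closed , _) , (_ , _ , 𝒮∩𝒞-trivial , _)) ,
                   complete , (f , cont , onto , into)) =
  not-¬ refl (trans (sym n∈U) (𝒮∩𝒞-trivial U U∈𝒮 U∈𝒞 n))
  where
  X-splits = Game.splitting-colouring lem f cont λ α β → infinite _ (∩-closed _ _ (into α) (into β))
  X = proj₁ X-splits

  splits : ∀ S → 𝒮 S → Splits X S
  splits S S∈𝒮 = let α , fα≐S = onto S S∈𝒮 in Splits-≐ fα≐S (proj₂ X-splits α)

  U∈𝒞 : 𝒞 U
  U∈𝒞 = 𝒞-≐ _ U (λ i → ∧-∨-∧-not (U i) (X i))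
          (∪-closed _ _ (colour-class-∈𝒞 complete 𝒞-≐ X splits)
                        (colour-class-∈𝒞 complete 𝒞-≐ (not ∘ X) λ S S∈𝒮 → Splits-not (splits S S∈𝒮)))
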